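{- There is an absolute constant $c$ such that for every positive integer $r$ there is $n_0(r)\le c\,6^r$ with the following property: for every $n>n_0(r)$ and every $r$-coloring of $\{0,1,2,3\}^n$ there are three points $x=(x_1,\dots,x_n)$, $y=(y_1,\dots,y_n)$, $z=(z_1,\dots,z_n)$ of the same color such that for every coordinate $i$ either $x_i=y_i=z_i$, or $(x_i,y_i,z_i)=(0,1,2)$, or $(x_i,y_i,z_i)=(3,2,1)$, and at least one coordinate is not of the first (constant) type. -}

module Defs where

open import Data.Nat using (ℕ)
open import Data.Fin using (Fin; zero; suc)
open import Data.Product using (_×_; ∃)
open import Data.Sum using (_⊎_)
open import Relation.Binary.PropositionalEquality using (_≡_)

Four : Set
Four = Fin 4

Point : ℕ → Set
Point n = Fin n → Four

a0 a1 a2 a3 : Four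
a0 = zero
a1 = suc zero
a2 = suc (suc zero)
a3 = suc (suc (suc zero))

ConstantAt : ∀ {n} → Point n → Point n → Point n → Fin n → Set
ConstantAt x y z i = (x i ≡ y i) × (y i ≡ z i)

MovingAt : ∀ {n} → Point n → Point n → Point n → Fin n → Set
MovingAt x y z i =
  ((x i ≡ a0) × (y i ≡ a1) × (z i ≡ a2)) ⊎ ((x i ≡ a3) × (y i ≡ a2) × (z i ≡ a1))

Configuration : ∀ {n} → Point n → Point n → Point n → Set
Configuration {n} x y z =
  (∀ (i : Fin n) → ConstantAt x y z i ⊎ MovingAt x y z i)
  × ∃ (λ (i : Fin n) → MovingAt x y z i)

-- Idea: colour focusing driven by a density argument.  A letter of {0,1,2,3} is encoded by a
-- pair of bits, so a pair (a, b) of points of the Boolean cube {0,1}^m names a point of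
-- {0,1,2,3}^m.  For a ≠ b the three points (a,b), (a,a), (b,b) form a configuration
-- ('diagonal-line'), and such line patterns survive prefixing by fixed pairs and padding.
-- A 'State' consists of a pattern-preserving frame into {0,1,2,3}^n, a set K of active cube
-- points and a set A of allowed colours, such that every pair a ≠ b in K is coloured from A.
-- One 'step' splits the cube as {0,1}^g × {0,1}^m.  Counting shows that many pairs of points
-- (β++z, β′++z) with β ≠ β′ lie in K, and averaging picks β, β′ and a colour c carried by a
-- dense set of such z.  Restricted to those z, either a new pair has colour c, which together
-- with the two diagonal points (both coloured c) is monochromatic, or c leaves A.  After r
-- steps no colour is left, so a monochromatic configuration must appear.
--
-- The theorem then pads any larger n.
module Submission where

open import Defs
open import Data.Bool using (Bool; true; false; _∧_; not; T)
open import Data.Bool.Properties using (T-∧) renaming (_≟_ to _≟ᵇ_)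
open import Data.Fin using (Fin; zero; suc)
open import Data.Fin.Properties using (_≟_; suc-injective)
open import Data.Fin.Subset using (Subset; _∈_; _-_; ∣_∣; ⊤)
open import Data.Fin.Subset.Properties using (∈⊤; ∣⊤∣≡n; x∈p∧x≢y⇒x∈p-y; x∈p⇒∣p-x∣<∣p∣)
open import Data.Nat using (ℕ; zero; suc; _+_; _*_; _^_; _≤_; _<_; _∸_; z≤n; s≤s; NonZero; >-nonZero; ≢-nonZero⁻¹)
open import Data.Nat.Properties hiding (_≟_; suc-injective)
open import Data.Nat.Tactic.RingSolver using (solve-∀)
open import Data.Product using (_×_; _,_; ∃; Σ)
open import Data.Sum using (_⊎_; inj₁; inj₂; [_,_]′)
open import Data.Unit using (tt)
open import Data.Vec using (Vec; []; _∷_; _++_; lookup; replicate)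
open import Data.Vec.Properties using (≡-dec; ∷-injectiveʳ; ++-injectiveˡ)
open import Function using (_∘_; id)
open import Function.Bundles using (Equivalence)
open import Relation.Binary.Definitions using (DecidableEquality)
open import Relation.Binary.PropositionalEquality
open import Relation.Nullary using (¬_; Dec; contradiction; yes; no)
open import Relation.Nullary.Decidable using (⌊_⌋; isYes≗does; dec-true; dec-false; toWitness; toWitnessFalse)
open import Algebra.Properties.CommutativeSemigroup +-commutativeSemigroup using ()
  renaming (interchange to +-interchange)
open import Algebra.Properties.Semiring.Sum +-*-semiring using (sum; sum-cong-≗; sum-replicate-zero)

n<b^n : ∀ {b} n → 2 ≤ b → n < b ^ n
n<b^n zero    _   = s≤s z≤n
n<b^n {b} (suc n) 2≤b = begin-strict
  suc n         ≤⟨ ih ⟩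
  b ^ n         <⟨ m<m+n (b ^ n) (≤-trans (s≤s z≤n) ih) ⟩
  b ^ n + b ^ n ≡⟨ cong (b ^ n +_) (+-identityʳ (b ^ n)) ⟨
  2 * b ^ n     ≤⟨ *-monoˡ-≤ (b ^ n) 2≤b ⟩
  b * b ^ n     ∎
  where
  open ≤-Reasoning
  ih : n < b ^ n
  ih = n<b^n n 2≤b

^-distribʳ-* : ∀ a b t → (a * b) ^ t ≡ a ^ t * b ^ t
^-distribʳ-* a b zero    = refl
^-distribʳ-* a b (suc t) = trans (cong (a * b *_) (^-distribʳ-* a b t)) (regroup a b (a ^ t) (b ^ t))
  where
  regroup : ∀ a b x y → a * b * (x * y) ≡ a * x * (b * y)
  regroup = solve-∀

larger-of : ∀ {A : Set} (f : A → ℕ) {a b p q} u v → a ≤ p * f u → b ≤ q * f v →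
  ∃ λ w → a + b ≤ (p + q) * f w
larger-of f {a} {b} {p} {q} u v a≤ b≤ with ≤-total (f u) (f v)
... | inj₁ fu≤fv = v , (begin
  a + b             ≤⟨ +-mono-≤ (≤-trans a≤ (*-monoʳ-≤ p fu≤fv)) b≤ ⟩
  p * f v + q * f v ≡⟨ *-distribʳ-+ (f v) p q ⟨
  (p + q) * f v     ∎)
  where open ≤-Reasoning
... | inj₂ fv≤fu = u , (begin
  a + b             ≤⟨ +-mono-≤ a≤ (≤-trans b≤ (*-monoʳ-≤ q fv≤fu)) ⟩
  p * f u + q * f u ≡⟨ *-distribʳ-+ (f u) p q ⟨
  (p + q) * f u     ∎)
  where open ≤-Reasoning

⌊⌋-true : ∀ {A : Set} (d : Dec A) → A → ⌊ d ⌋ ≡ true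
⌊⌋-true d a = trans (isYes≗does d) (dec-true d a)

⌊⌋-false : ∀ {A : Set} (d : Dec A) → ¬ A → ⌊ d ⌋ ≡ false
⌊⌋-false d ¬a = trans (isYes≗does d) (dec-false d ¬a)

-- Sums over the Boolean cube {0,1}^m; subsets of the cube are Boolean predicates, counted by #.

Cube : ℕ → Set
Cube m = Vec Bool m

_≟ᶜ_ : ∀ {m} → DecidableEquality (Cube m)
_≟ᶜ_ = ≡-dec _≟ᵇ_

∑ᶜ : ∀ {m} → (Cube m → ℕ) → ℕ
∑ᶜ {zero}  f = f []
∑ᶜ {suc m} f = ∑ᶜ (f ∘ (false ∷_)) + ∑ᶜ (f ∘ (true ∷_))

𝟙 : Bool → ℕ
𝟙 true  = 1
𝟙 false = 0

#_ : ∀ {m} → (Cube m → Bool) → ℕ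
# Q = ∑ᶜ (𝟙 ∘ Q)

∑ᶜ-cong : ∀ {m} {f h : Cube m → ℕ} → (∀ v → f v ≡ h v) → ∑ᶜ f ≡ ∑ᶜ h
∑ᶜ-cong {zero}  f≗h = f≗h []
∑ᶜ-cong {suc m} f≗h = cong₂ _+_ (∑ᶜ-cong (f≗h ∘ (false ∷_))) (∑ᶜ-cong (f≗h ∘ (true ∷_)))

∑ᶜ-mono : ∀ {m} {f h : Cube m → ℕ} → (∀ v → f v ≤ h v) → ∑ᶜ f ≤ ∑ᶜ h
∑ᶜ-mono {zero}  f≤h = f≤h []
∑ᶜ-mono {suc m} f≤h = +-mono-≤ (∑ᶜ-mono (f≤h ∘ (false ∷_))) (∑ᶜ-mono (f≤h ∘ (true ∷_)))

∑ᶜ-+ : ∀ {m} (f h : Cube m → ℕ) → ∑ᶜ (λ v → f v + h v) ≡ ∑ᶜ f + ∑ᶜ h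
∑ᶜ-+ {zero}  f h = refl
∑ᶜ-+ {suc m} f h = trans
  (cong₂ _+_ (∑ᶜ-+ (f ∘ (false ∷_)) (h ∘ (false ∷_))) (∑ᶜ-+ (f ∘ (true ∷_)) (h ∘ (true ∷_))))
  (+-interchange (∑ᶜ (f ∘ (false ∷_))) (∑ᶜ (h ∘ (false ∷_))) (∑ᶜ (f ∘ (true ∷_))) (∑ᶜ (h ∘ (true ∷_))))

∑ᶜ-const : ∀ {m} k → ∑ᶜ {m} (λ _ → k) ≡ 2 ^ m * k
∑ᶜ-const {zero}  k = sym (*-identityˡ k)
∑ᶜ-const {suc m} k = trans (cong₂ _+_ (∑ᶜ-const {m} k) (∑ᶜ-const {m} k)) (double (2 ^ m) k)
  where
  double : ∀ a k → a * k + a * k ≡ 2 * a * k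
  double = solve-∀

∑ᶜ-zero : ∀ {m} {f : Cube m → ℕ} → (∀ v → f v ≡ 0) → ∑ᶜ f ≡ 0
∑ᶜ-zero {m} f≗0 = trans (∑ᶜ-cong f≗0) (trans (∑ᶜ-const {m} 0) (*-zeroʳ (2 ^ m)))

∑ᶜ-++ : ∀ g {m} (f : Cube (g + m) → ℕ) → ∑ᶜ f ≡ ∑ᶜ {g} (λ β → ∑ᶜ {m} (λ z → f (β ++ z)))
∑ᶜ-++ zero        f = refl
∑ᶜ-++ (suc g) {m} f = cong₂ _+_ (∑ᶜ-++ g {m} (f ∘ (false ∷_))) (∑ᶜ-++ g {m} (f ∘ (true ∷_)))

∑ᶜ-swap : ∀ {a b} (f : Cube a → Cube b → ℕ) →
  ∑ᶜ (λ u → ∑ᶜ (λ v → f u v)) ≡ ∑ᶜ (λ v → ∑ᶜ (λ u → f u v))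
∑ᶜ-swap {zero}      f = refl
∑ᶜ-swap {suc a} {b} f = trans
  (cong₂ _+_ (∑ᶜ-swap (f ∘ (false ∷_))) (∑ᶜ-swap (f ∘ (true ∷_))))
  (sym (∑ᶜ-+ {b} (λ v → ∑ᶜ (λ u → f (false ∷ u) v)) (λ v → ∑ᶜ (λ u → f (true ∷ u) v))))

∑ᶜ-single : ∀ {m} (f : Cube m → ℕ) w → f w ≤ ∑ᶜ f
∑ᶜ-single {zero}  f []          = ≤-refl
∑ᶜ-single {suc m} f (false ∷ w) = ≤-trans (∑ᶜ-single (f ∘ (false ∷_)) w) (m≤m+n _ _)
∑ᶜ-single {suc m} f (true ∷ w)  = ≤-trans (∑ᶜ-single (f ∘ (true ∷_)) w) (m≤n+m _ _)

∑ᶜ-point : ∀ {m} (f : Cube m → ℕ) w → (∀ v → v ≢ w → f v ≡ 0) → ∑ᶜ f ≡ f w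
∑ᶜ-point {zero}  f []          _   = refl
∑ᶜ-point {suc m} f (false ∷ w) off = trans
  (cong₂ _+_ (∑ᶜ-point (f ∘ (false ∷_)) w (λ v v≢w → off _ (v≢w ∘ ∷-injectiveʳ)))
             (∑ᶜ-zero {m} (λ v → off _ (λ ()))))
  (+-identityʳ _)
∑ᶜ-point {suc m} f (true ∷ w)  off =
  cong₂ _+_ (∑ᶜ-zero {m} (λ v → off _ (λ ())))
            (∑ᶜ-point (f ∘ (true ∷_)) w (λ v v≢w → off _ (v≢w ∘ ∷-injectiveʳ)))

∑ᶜ-max : ∀ {m} (f : Cube m → ℕ) → ∃ λ v → ∑ᶜ f ≤ 2 ^ m * f v
∑ᶜ-max {zero}  f = [] , ≤-reflexive (sym (*-identityˡ _))
∑ᶜ-max {suc m} f =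
  let u , ∑₀≤ = ∑ᶜ-max (f ∘ (false ∷_))
      v , ∑₁≤ = ∑ᶜ-max (f ∘ (true ∷_))
      w , ∑≤  = larger-of f {p = 2 ^ m} {2 ^ m} (false ∷ u) (true ∷ v) ∑₀≤ ∑₁≤
  in w , subst (λ k → ∑ᶜ f ≤ (2 ^ m + k) * f w) (sym (+-identityʳ (2 ^ m))) ∑≤

inhabited-or-empty : ∀ {m} (Q : Cube m → Bool) → ∃ (λ z → T (Q z)) ⊎ # Q ≡ 0
inhabited-or-empty {m} Q with ∑ᶜ-max (𝟙 ∘ Q)
... | v , #Q≤ with Q v in Qv | #Q≤
...   | true  | _    = inj₁ (v , subst T (sym Qv) tt)
...   | false | #Q≤0 = inj₂ (n≤0⇒n≡0 (≤-trans #Q≤0 (≤-reflexive (*-zeroʳ (2 ^ m)))))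

sum-zero : ∀ {r} {f : Fin r → ℕ} → (∀ i → f i ≡ 0) → sum f ≡ 0
sum-zero {r} f≗0 = trans (sum-cong-≗ f≗0) (sum-replicate-zero r)

sum-point : ∀ {r} (f : Fin r → ℕ) i → (∀ j → j ≢ i → f j ≡ 0) → sum f ≡ f i
sum-point f zero    off = trans (cong (f zero +_) (sum-zero (λ j → off (suc j) (λ ())))) (+-identityʳ _)
sum-point f (suc i) off =
  cong₂ _+_ (off zero (λ ())) (sum-point (f ∘ suc) i (λ j j≢i → off (suc j) (j≢i ∘ suc-injective)))

sum-max : ∀ {r} .{{_ : NonZero r}} (f : Fin r → ℕ) → ∃ λ i → sum f ≤ r * f i
sum-max {zero}        f = contradiction refl (≢-nonZero⁻¹ 0)
sum-max {suc zero}    f = zero , ≤-refl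
sum-max {suc (suc r)} f =
  let j , rest≤ = sum-max (f ∘ suc)
  in larger-of f {p = 1} {suc r} zero (suc j) (≤-reflexive (sym (*-identityˡ (f zero)))) rest≤

sum-∑ᶜ : ∀ {r m} (f : Fin r → Cube m → ℕ) → sum (λ i → ∑ᶜ (f i)) ≡ ∑ᶜ (λ v → sum (λ i → f i v))
sum-∑ᶜ {zero}  {m} f = sym (∑ᶜ-zero {m} (λ _ → refl))
sum-∑ᶜ {suc r} {m} f = trans (cong (∑ᶜ (f zero) +_) (sum-∑ᶜ (f ∘ suc)))
                             (sym (∑ᶜ-+ (f zero) (λ v → sum (λ i → f (suc i) v))))

colour-count : ∀ {r} b (k : Fin r) → sum (λ c → 𝟙 (b ∧ ⌊ k ≟ c ⌋)) ≡ 𝟙 b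
colour-count {r} false k = sum-zero {r} (λ _ → refl)
colour-count     true  k = trans
  (sum-point (λ c → 𝟙 ⌊ k ≟ c ⌋) k (λ c c≢k → cong 𝟙 (⌊⌋-false (k ≟ c) (c≢k ∘ sym))))
  (cong 𝟙 (⌊⌋-true (k ≟ k) refl))

#-colours : ∀ {m r} (W : Cube m → Bool) (κ : Cube m → Fin r) →
  # W ≡ sum (λ c → # (λ z → W z ∧ ⌊ κ z ≟ c ⌋))
#-colours W κ = sym (trans (sum-∑ᶜ (λ c z → 𝟙 (W z ∧ ⌊ κ z ≟ c ⌋)))
                           (∑ᶜ-cong (λ z → colour-count (W z) (κ z))))

pairs : ∀ {g} → (Cube g → Bool) → ℕ
pairs Q = ∑ᶜ λ β → ∑ᶜ λ β′ → 𝟙 (Q β ∧ (Q β′ ∧ not ⌊ β ≟ᶜ β′ ⌋))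

-- Each element other than a fixed element q₀ of Q forms a pair with it.
row-bound : ∀ q₀ q d → T q₀ → 𝟙 q ≤ 𝟙 (q₀ ∧ (q ∧ not d)) + 𝟙 d
row-bound true false d     _ = z≤n
row-bound true true  false _ = s≤s z≤n
row-bound true true  true  _ = s≤s z≤n

#≤pairs+1 : ∀ {g} (Q : Cube g → Bool) → # Q ≤ pairs Q + 1
#≤pairs+1 {g} Q with inhabited-or-empty Q
... | inj₂ #Q≡0 = subst (_≤ pairs Q + 1) (sym #Q≡0) z≤n
... | inj₁ (β₀ , Qβ₀) = begin
  # Q
    ≤⟨ ∑ᶜ-mono (λ β → row-bound (Q β₀) (Q β) ⌊ β₀ ≟ᶜ β ⌋ Qβ₀) ⟩
  ∑ᶜ (λ β → row β + 𝟙 ⌊ β₀ ≟ᶜ β ⌋)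
    ≡⟨ ∑ᶜ-+ row (λ β → 𝟙 ⌊ β₀ ≟ᶜ β ⌋) ⟩
  ∑ᶜ row + ∑ᶜ (λ β → 𝟙 ⌊ β₀ ≟ᶜ β ⌋)
    ≡⟨ cong (∑ᶜ row +_) (∑ᶜ-point _ β₀ (λ β β≢β₀ → cong 𝟙 (⌊⌋-false (β₀ ≟ᶜ β) (β≢β₀ ∘ sym)))) ⟩
  ∑ᶜ row + 𝟙 ⌊ β₀ ≟ᶜ β₀ ⌋
    ≡⟨ cong (λ b → ∑ᶜ row + 𝟙 b) (⌊⌋-true (β₀ ≟ᶜ β₀) refl) ⟩
  ∑ᶜ row + 1
    ≤⟨ +-monoˡ-≤ 1 (∑ᶜ-single (λ β → ∑ᶜ λ β′ → 𝟙 (Q β ∧ (Q β′ ∧ not ⌊ β ≟ᶜ β′ ⌋))) β₀) ⟩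
  pairs Q + 1 ∎
  where
  open ≤-Reasoning
  row : Cube g → ℕ
  row β = 𝟙 (Q β₀ ∧ (Q β ∧ not ⌊ β₀ ≟ᶜ β ⌋))

link : ∀ {g m} → (Cube (g + m) → Bool) → Cube g → Cube g → Cube m → Bool
link K β β′ z = K (β ++ z) ∧ (K (β′ ++ z) ∧ not ⌊ β ≟ᶜ β′ ⌋)

-- Summing #≤pairs+1 over the 2^m fibres: K has at most 2^m more points than links.
#≤links : ∀ g {m} (K : Cube (g + m) → Bool) →
  # K ≤ ∑ᶜ {g} (λ β → ∑ᶜ {g} (λ β′ → # link {g} {m} K β β′)) + 2 ^ m
#≤links g {m} K = begin
  # K
    ≡⟨ ∑ᶜ-++ g (𝟙 ∘ K) ⟩
  ∑ᶜ {g} (λ β → ∑ᶜ {m} (λ z → 𝟙 (K (β ++ z))))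
    ≡⟨ ∑ᶜ-swap (λ (β : Cube g) (z : Cube m) → 𝟙 (K (β ++ z))) ⟩
  ∑ᶜ (λ z → # fibre z)
    ≤⟨ ∑ᶜ-mono (λ z → #≤pairs+1 (fibre z)) ⟩
  ∑ᶜ (λ z → pairs (fibre z) + 1)
    ≡⟨ ∑ᶜ-+ (λ z → pairs (fibre z)) (λ _ → 1) ⟩
  ∑ᶜ (λ z → pairs (fibre z)) + ∑ᶜ {m} (λ _ → 1)
    ≡⟨ cong₂ _+_ reorder (trans (∑ᶜ-const {m} 1) (*-identityʳ (2 ^ m))) ⟩
  ∑ᶜ (λ β → ∑ᶜ (λ β′ → # link {g} {m} K β β′)) + 2 ^ m ∎
  where
  open ≤-Reasoning
  fibre : Cube m → Cube g → Bool
  fibre z β = K (β ++ z)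
  reorder : ∑ᶜ (λ z → pairs (fibre z)) ≡ ∑ᶜ (λ β → ∑ᶜ (λ β′ → # link {g} {m} K β β′))
  reorder = trans (sym (∑ᶜ-swap (λ β z → ∑ᶜ (λ β′ → 𝟙 (link {g} {m} K β β′ z)))))
                  (∑ᶜ-cong (λ β → ∑ᶜ-swap (λ z β′ → 𝟙 (link {g} {m} K β β′ z))))

heavy-triple : ∀ {g r} .{{_ : NonZero r}} (F : Cube g → Cube g → Fin r → ℕ) {M} →
  M ≤ ∑ᶜ (λ β → ∑ᶜ (λ β′ → sum (F β β′))) →
  ∃ λ β → ∃ λ β′ → ∃ λ c → M ≤ 2 ^ (g + g + r) * F β β′ c
heavy-triple {g} {r} F {M} M≤ =
  let β  , ≤β  = ∑ᶜ-max (λ β → ∑ᶜ (λ β′ → sum (F β β′)))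
      β′ , ≤β′ = ∑ᶜ-max (λ β′ → sum (F β β′))
      c  , ≤c  = sum-max (F β β′)
  in β , β′ , c , (begin
  M                                      ≤⟨ M≤ ⟩
  ∑ᶜ (λ β → ∑ᶜ (λ β′ → sum (F β β′)))    ≤⟨ ≤β ⟩
  2 ^ g * ∑ᶜ (λ β′ → sum (F β β′))       ≤⟨ *-monoʳ-≤ (2 ^ g) ≤β′ ⟩
  2 ^ g * (2 ^ g * sum (F β β′))         ≤⟨ *-monoʳ-≤ (2 ^ g) (*-monoʳ-≤ (2 ^ g) ≤c) ⟩
  2 ^ g * (2 ^ g * (r * F β β′ c))       ≤⟨ weight (F β β′ c) ⟩
  2 ^ (g + g + r) * F β β′ c             ∎)
  where
  open ≤-Reasoning
  regroup : ∀ a b c x → a * (b * (c * x)) ≡ a * b * c * x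
  regroup = solve-∀
  weight : ∀ x → 2 ^ g * (2 ^ g * (r * x)) ≤ 2 ^ (g + g + r) * x
  weight x = begin
    2 ^ g * (2 ^ g * (r * x))     ≤⟨ *-monoʳ-≤ (2 ^ g) (*-monoʳ-≤ (2 ^ g) (*-monoˡ-≤ x (<⇒≤ (n<b^n r ≤-refl)))) ⟩
    2 ^ g * (2 ^ g * (2 ^ r * x)) ≡⟨ regroup (2 ^ g) (2 ^ g) (2 ^ r) x ⟩
    2 ^ g * 2 ^ g * 2 ^ r * x     ≡⟨ cong (λ k → k * 2 ^ r * x) (^-distribˡ-+-* 2 g g) ⟨
    2 ^ (g + g) * 2 ^ r * x       ≡⟨ cong (_* x) (^-distribˡ-+-* 2 (g + g) r) ⟨
    2 ^ (g + g + r) * x           ∎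

-- Encoding points of {0,1,2,3}^m by pairs of cube points, and line patterns.

letter : Bool → Bool → Four
letter false true  = a0
letter false false = a1
letter true  true  = a2
letter true  false = a3

encode : ∀ {m} → Cube m → Cube m → Point m
encode a b i = letter (lookup a i) (lookup b i)

-- The admissible behaviour of one coordinate of three encoded points (xₖ, yₖ):
-- constant, or (x, ¬x), (x, x), (¬x, ¬x), which reads (0,1,2) for x = 0 and (3,2,1) for x = 1.
data Shape : (x₁ y₁ x₂ y₂ x₃ y₃ : Bool) → Set where
  still : ∀ {x y} → Shape x y x y x y
  move  : ∀ x → Shape x (not x) x x (not x) (not x)

data Shapes : ∀ {m} (a₁ b₁ a₂ b₂ a₃ b₃ : Cube m) → Set where
  []  : Shapes [] [] [] [] [] []
  _∷_ : ∀ {m x₁ y₁ x₂ y₂ x₃ y₃} {a₁ b₁ a₂ b₂ a₃ b₃ : Cube m} →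
        Shape x₁ y₁ x₂ y₂ x₃ y₃ → Shapes a₁ b₁ a₂ b₂ a₃ b₃ →
        Shapes (x₁ ∷ a₁) (y₁ ∷ b₁) (x₂ ∷ a₂) (y₂ ∷ b₂) (x₃ ∷ a₃) (y₃ ∷ b₃)

data Line : ∀ {m} (a₁ b₁ a₂ b₂ a₃ b₃ : Cube m) → Set where
  moves-here : ∀ {m} x {a₁ b₁ a₂ b₂ a₃ b₃ : Cube m} → Shapes a₁ b₁ a₂ b₂ a₃ b₃ →
               Line (x ∷ a₁) (not x ∷ b₁) (x ∷ a₂) (x ∷ b₂) (not x ∷ a₃) (not x ∷ b₃)
  still-here : ∀ {m x y} {a₁ b₁ a₂ b₂ a₃ b₃ : Cube m} → Line a₁ b₁ a₂ b₂ a₃ b₃ →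
               Line (x ∷ a₁) (y ∷ b₁) (x ∷ a₂) (y ∷ b₂) (x ∷ a₃) (y ∷ b₃)

Moving : Four → Four → Four → Set
Moving p q s = ((p ≡ a0) × (q ≡ a1) × (s ≡ a2)) ⊎ ((p ≡ a3) × (q ≡ a2) × (s ≡ a1))

moving : ∀ x → Moving (letter x (not x)) (letter x x) (letter (not x) (not x))
moving false = inj₁ (refl , refl , refl)
moving true  = inj₂ (refl , refl , refl)

shape-column : ∀ {x₁ y₁ x₂ y₂ x₃ y₃} → Shape x₁ y₁ x₂ y₂ x₃ y₃ →
  let p = letter x₁ y₁ ; q = letter x₂ y₂ ; s = letter x₃ y₃ in
  ((p ≡ q) × (q ≡ s)) ⊎ Moving p q s
shape-column still    = inj₁ (refl , refl)
shape-column (move x) = inj₂ (moving x)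

shapes-columns : ∀ {m} {a₁ b₁ a₂ b₂ a₃ b₃ : Cube m} → Shapes a₁ b₁ a₂ b₂ a₃ b₃ →
  let x = encode a₁ b₁ ; y = encode a₂ b₂ ; z = encode a₃ b₃ in
  ∀ i → ConstantAt x y z i ⊎ MovingAt x y z i
shapes-columns (σ ∷ _)  zero    = shape-column σ
shapes-columns (_ ∷ σs) (suc i) = shapes-columns σs i

line-configuration : ∀ {m} {a₁ b₁ a₂ b₂ a₃ b₃ : Cube m} → Line a₁ b₁ a₂ b₂ a₃ b₃ →
  Configuration (encode a₁ b₁) (encode a₂ b₂) (encode a₃ b₃)
line-configuration (moves-here x σs) =
  (λ { zero → shape-column (move x) ; (suc i) → shapes-columns σs i }) , (zero , moving x)
line-configuration (still-here ℓ) =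
  let columns , (j , moves) = line-configuration ℓ
  in (λ { zero → inj₁ (refl , refl) ; (suc i) → columns i }) , (suc j , moves)

line-prefix : ∀ {g m} (β β′ : Cube g) {a₁ b₁ a₂ b₂ a₃ b₃ : Cube m} → Line a₁ b₁ a₂ b₂ a₃ b₃ →
  Line (β ++ a₁) (β′ ++ b₁) (β ++ a₂) (β′ ++ b₂) (β ++ a₃) (β′ ++ b₃)
line-prefix []      []       ℓ = ℓ
line-prefix (_ ∷ β) (_ ∷ β′) ℓ = still-here (line-prefix β β′ ℓ)

shapes-pad : ∀ {m d} {a₁ b₁ a₂ b₂ a₃ b₃ : Cube m} (p : Cube d) → Shapes a₁ b₁ a₂ b₂ a₃ b₃ →
  Shapes (a₁ ++ p) (b₁ ++ p) (a₂ ++ p) (b₂ ++ p) (a₃ ++ p) (b₃ ++ p)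
shapes-pad []      []       = []
shapes-pad (_ ∷ p) []       = still ∷ shapes-pad p []
shapes-pad p       (σ ∷ σs) = σ ∷ shapes-pad p σs

line-pad : ∀ {m d} {a₁ b₁ a₂ b₂ a₃ b₃ : Cube m} (p : Cube d) → Line a₁ b₁ a₂ b₂ a₃ b₃ →
  Line (a₁ ++ p) (b₁ ++ p) (a₂ ++ p) (b₂ ++ p) (a₃ ++ p) (b₃ ++ p)
line-pad p (moves-here x σs) = moves-here x (shapes-pad p σs)
line-pad p (still-here ℓ)    = still-here (line-pad p ℓ)

diagonal-shape : ∀ x y → Shape x y x x y y
diagonal-shape false false = still
diagonal-shape false true  = move false
diagonal-shape true  false = move true
diagonal-shape true  true  = still

diagonal-shapes : ∀ {m} (z z′ : Cube m) → Shapes z z′ z z z′ z′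
diagonal-shapes []      []       = []
diagonal-shapes (x ∷ z) (y ∷ z′) = diagonal-shape x y ∷ diagonal-shapes z z′

diagonal-line : ∀ {m} {z z′ : Cube m} → z ≢ z′ → Line z z′ z z z′ z′
diagonal-line {z = []}        {[]}         z≢z′ = contradiction refl z≢z′
diagonal-line {z = false ∷ z} {false ∷ z′} z≢z′ = still-here (diagonal-line (z≢z′ ∘ cong (false ∷_)))
diagonal-line {z = true ∷ z}  {true ∷ z′}  z≢z′ = still-here (diagonal-line (z≢z′ ∘ cong (true ∷_)))
diagonal-line {z = false ∷ z} {true ∷ z′}  _    = moves-here false (diagonal-shapes z z′)
diagonal-line {z = true ∷ z}  {false ∷ z′} _    = moves-here true (diagonal-shapes z z′)

-- Colour focusing.

Monochromatic : ∀ {r n} → (Point n → Fin r) → Set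
Monochromatic {n = n} χ = ∃ λ (x : Point n) → ∃ λ (y : Point n) → ∃ λ (z : Point n) →
  (χ x ≡ χ y) × (χ y ≡ χ z) × Configuration x y z

-- The cube dimension sufficient for k focusing steps starting from density 2^-e:
-- each step uses e + 1 coordinates and leaves density 2^-(2(e+1)+r).
dimension : ℕ → ℕ → ℕ → ℕ
dimension r zero    e = suc e + 0
dimension r (suc k) e = suc e + dimension r k (suc e + suc e + r)

halve : ∀ e m {x} → 2 ^ (suc e + m) ≤ 2 ^ e * x → 2 * 2 ^ m ≤ x
halve e m {x} dense = *-cancelˡ-≤ (2 ^ e) {{m^n≢0 2 e}} (subst (_≤ 2 ^ e * x) split-power dense)
  where
  regroup : ∀ a b → 2 * (a * b) ≡ a * (2 * b)
  regroup = solve-∀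
  split-power : 2 ^ (suc e + m) ≡ 2 ^ e * (2 * 2 ^ m)
  split-power = trans (cong (2 *_) (^-distribˡ-+-* 2 e m)) (regroup (2 ^ e) (2 ^ m))

module Focusing {r n : ℕ} .{{_ : NonZero r}} (χ : Point n → Fin r) where

  record State (m : ℕ) : Set where
    field
      frame       : Cube m → Cube m → Point n
      frame-line  : ∀ {a₁ b₁ a₂ b₂ a₃ b₃} → Line a₁ b₁ a₂ b₂ a₃ b₃ →
                    Configuration (frame a₁ b₁) (frame a₂ b₂) (frame a₃ b₃)
      active      : Cube m → Bool
      allowed     : Subset r
      edge-colour : ∀ {a b} → T (active a) → T (active b) → a ≢ b →
                    χ (frame a b) ∈ allowed ⊎ Monochromatic χ
  open State

  Dense : ∀ {m} → ℕ → State m → Set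
  Dense {m} e S = 2 ^ m ≤ 2 ^ e * # active S

  module Step (g m : ℕ) (S : State (g + m)) where

    linked : Cube g → Cube g → Cube m → Bool
    linked = link {g} {m} (active S)

    colour-of : Cube g → Cube g → Cube m → Fin r
    colour-of β β′ z = χ (frame S (β ++ z) (β′ ++ z))

    coloured-link : Cube g → Cube g → Fin r → Cube m → Bool
    coloured-link β β′ c z = linked β β′ z ∧ ⌊ colour-of β β′ z ≟ c ⌋

    coloured-link-parts : ∀ {β β′ c z} → T (coloured-link β β′ c z) →
      T (active S (β ++ z)) × T (active S (β′ ++ z)) × β ≢ β′ × colour-of β β′ z ≡ c
    coloured-link-parts t =
      let l , same = Equivalence.to T-∧ t
          a , rest = Equivalence.to T-∧ l
          a′ , ne  = Equivalence.to T-∧ rest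
      in a , a′ , toWitnessFalse ne , toWitness same

    -- A new pair coloured c closes a monochromatic configuration with its two diagonal points;
    -- any other new pair is an old pair, so its colour lies in allowed S without c.
    restrict : (β β′ : Cube g) → Fin r → State m
    restrict β β′ c = record
      { frame       = λ z z′ → frame S (β ++ z) (β′ ++ z′)
      ; frame-line  = frame-line S ∘ line-prefix β β′
      ; active      = coloured-link β β′ c
      ; allowed     = allowed S - c
      ; edge-colour = colour-avoided
      }
      where
      colour-avoided : ∀ {z z′} → T (coloured-link β β′ c z) → T (coloured-link β β′ c z′) → z ≢ z′ →
        χ (frame S (β ++ z) (β′ ++ z′)) ∈ allowed S - c ⊎ Monochromatic χ
      colour-avoided {z} {z′} t t′ z≢z′ with coloured-link-parts t | coloured-link-parts t′
      ... | a , _ , β≢β′ , c-at-z | _ , a′ , _ , c-at-z′ with χ (frame S (β ++ z) (β′ ++ z′)) ≟ c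
      ...   | yes same = inj₂ (frame S (β ++ z) (β′ ++ z′) , frame S (β ++ z) (β′ ++ z) , frame S (β ++ z′) (β′ ++ z′) ,
                               trans same (sym c-at-z) , trans c-at-z (sym c-at-z′) ,
                               frame-line S (line-prefix β β′ (diagonal-line z≢z′)))
      ...   | no differ with edge-colour S a a′ (β≢β′ ∘ ++-injectiveˡ β β′)
      ...     | inj₁ allowed-c′ = inj₁ (x∈p∧x≢y⇒x∈p-y allowed-c′ differ)
      ...     | inj₂ mono       = inj₂ mono

    many-links : 2 * 2 ^ m ≤ # active S →
      2 ^ m ≤ ∑ᶜ (λ β → ∑ᶜ (λ β′ → sum (λ c → # coloured-link β β′ c)))
    many-links large = +-cancelʳ-≤ (2 ^ m) (2 ^ m) _ (begin
      2 ^ m + 2 ^ m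
        ≡⟨ cong (2 ^ m +_) (+-identityʳ (2 ^ m)) ⟨
      2 * 2 ^ m
        ≤⟨ large ⟩
      # active S
        ≤⟨ #≤links g (active S) ⟩
      ∑ᶜ (λ β → ∑ᶜ (λ β′ → # linked β β′)) + 2 ^ m
        ≡⟨ cong (_+ 2 ^ m) (∑ᶜ-cong λ β → ∑ᶜ-cong λ β′ → #-colours (linked β β′) (colour-of β β′)) ⟩
      ∑ᶜ (λ β → ∑ᶜ (λ β′ → sum (λ c → # coloured-link β β′ c))) + 2 ^ m ∎)
      where open ≤-Reasoning

    heavy-class : 2 * 2 ^ m ≤ # active S →
      ∃ λ β → ∃ λ β′ → ∃ λ c → 2 ^ m ≤ 2 ^ (g + g + r) * # coloured-link β β′ c
    heavy-class large = heavy-triple {g} {r} (λ β β′ c → # coloured-link β β′ c) {2 ^ m} (many-links large)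

    Progress : Set
    Progress = Monochromatic χ ⊎ Σ (State m) (λ S′ → ∣ allowed S′ ∣ < ∣ allowed S ∣ × Dense (g + g + r) S′)

    -- A dense class is inhabited; its colour c is allowed, so restricting removes c from allowed S.
    shrink : (∃ λ β → ∃ λ β′ → ∃ λ c → 2 ^ m ≤ 2 ^ (g + g + r) * # coloured-link β β′ c) → Progress
    shrink (β , β′ , c , heavy) with inhabited-or-empty (coloured-link β β′ c)
    ... | inj₂ empty = contradiction
            (n≤0⇒n≡0 (≤-trans heavy (≤-reflexive (trans (cong (2 ^ (g + g + r) *_) empty) (*-zeroʳ (2 ^ (g + g + r)))))))
            (≢-nonZero⁻¹ (2 ^ m) {{m^n≢0 2 m}})
    ... | inj₁ (z , t) with coloured-link-parts t
    ...   | a , a′ , β≢β′ , c-at-z with edge-colour S a a′ (β≢β′ ∘ ++-injectiveˡ β β′)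
    ...     | inj₂ mono      = inj₁ mono
    ...     | inj₁ allowed-c = inj₂ (restrict β β′ c , x∈p⇒∣p-x∣<∣p∣ (subst (_∈ allowed S) c-at-z allowed-c) , heavy)

    step : 2 * 2 ^ m ≤ # active S → Progress
    step = shrink ∘ heavy-class

  -- Iterating the step: each one removes an allowed colour, so at most k more steps remain.
  focus : ∀ k e (S : State (dimension r k e)) → ∣ allowed S ∣ ≤ k → Dense e S → Monochromatic χ
  focus zero e S few dense =
    [ id , (λ { (_ , shrinks , _) → contradiction (≤-trans shrinks few) λ () }) ]′
    (Step.step (suc e) 0 S (halve e 0 dense))
  focus (suc k) e S few dense =
    [ id , (λ { (S′ , shrinks , dense′) → focus k (suc e + suc e + r) S′ (≤-pred (≤-trans shrinks few)) dense′ }) ]′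
    (Step.step (suc e) (dimension r k (suc e + suc e + r)) S (halve e _ dense))

-- The theorem in dimension dimension r r 0 + d: start from the whole cube, all colours allowed,
-- with the frame that encodes pairs and pads with the letter 1.
padded-cube : ∀ r d .{{_ : NonZero r}} (χ : Point (dimension r r 0 + d) → Fin r) → Monochromatic χ
padded-cube r d χ = focus r 0 start (≤-reflexive (∣⊤∣≡n r)) full
  where
  open Focusing χ
  N : ℕ
  N = dimension r r 0
  pad : Cube d
  pad = replicate d false
  start : State N
  start = record
    { frame       = λ a b → encode (a ++ pad) (b ++ pad)
    ; frame-line  = line-configuration ∘ line-pad pad
    ; active      = λ _ → true
    ; allowed     = ⊤
    ; edge-colour = λ _ _ _ → inj₁ ∈⊤
    }
  full : Dense 0 start
  full = ≤-reflexive (sym (trans (*-identityˡ _) (trans (∑ᶜ-const {N} 1) (*-identityʳ _))))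

-- The dimension bound: dimension r k e + (e + r + 2) ≤ 2^(k+1)·(e + r + 2), since the quantity
-- e + r + 2 doubles from one step to the next.
dimension-linear : ∀ r k e → dimension r k e + (e + r + 2) ≤ 2 ^ suc k * (e + r + 2)
dimension-linear r zero e = begin
  suc e + 0 + (e + r + 2)
    ≤⟨ +-monoˡ-≤ (e + r + 2) (subst (suc e + 0 ≤_) (shift e r) (m≤m+n (suc e + 0) (suc r))) ⟩
  (e + r + 2) + (e + r + 2)
    ≡⟨ cong ((e + r + 2) +_) (+-identityʳ (e + r + 2)) ⟨
  2 * (e + r + 2) ∎
  where
  open ≤-Reasoning
  shift : ∀ e r → suc e + 0 + suc r ≡ e + r + 2
  shift = solve-∀
dimension-linear r (suc k) e = begin
  suc e + dimension r k e′ + (e + r + 2)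
    ≡⟨ reorder (suc e) (dimension r k e′) (e + r + 2) ⟩
  dimension r k e′ + (suc e + (e + r + 2))
    ≤⟨ +-monoʳ-≤ (dimension r k e′) (subst (suc e + (e + r + 2) ≤_) (grow e r) (m≤m+n _ (suc r))) ⟩
  dimension r k e′ + (e′ + r + 2)
    ≤⟨ dimension-linear r k e′ ⟩
  2 ^ suc k * (e′ + r + 2)
    ≡⟨ double (2 ^ suc k) e r ⟩
  2 ^ suc (suc k) * (e + r + 2) ∎
  where
  open ≤-Reasoning
  e′ : ℕ
  e′ = suc e + suc e + r
  reorder : ∀ a b c → a + b + c ≡ b + (a + c)
  reorder = solve-∀
  grow : ∀ e r → suc e + (e + r + 2) + suc r ≡ suc e + suc e + r + r + 2
  grow = solve-∀
  double : ∀ p e r → p * (suc e + suc e + r + r + 2) ≡ 2 * p * (e + r + 2)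
  double = solve-∀

-- 2^(r+1)·(r+2) ≤ 2^(r+1)·3^(r+1) = 6^(r+1).
dimension-bound : ∀ r → dimension r r 0 ≤ 6 * 6 ^ r
dimension-bound r = begin
  dimension r r 0           ≤⟨ m≤m+n (dimension r r 0) (r + 2) ⟩
  dimension r r 0 + (r + 2) ≤⟨ dimension-linear r r 0 ⟩
  2 ^ suc r * (r + 2)       ≤⟨ *-monoʳ-≤ (2 ^ suc r) (subst (_≤ 3 ^ suc r) (+-comm 2 r) (n<b^n (suc r) (s≤s (s≤s z≤n)))) ⟩
  2 ^ suc r * 3 ^ suc r     ≡⟨ ^-distribʳ-* 2 3 (suc r) ⟨
  6 ^ suc r                 ∎
  where open ≤-Reasoning

corollary2 : ∃ λ (c : ℕ) → ∀ (r : ℕ) → 1 ≤ r →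
    ∃ λ (n₀ : ℕ) → (n₀ ≤ c * 6 ^ r) ×
      (∀ (n : ℕ) → n₀ < n → ∀ (χ : Point n → Fin r) →
        ∃ λ (x : Point n) → ∃ λ (y : Point n) → ∃ λ (z : Point n) →
          (χ x ≡ χ y) × (χ y ≡ χ z) × Configuration x y z)
corollary2 = 6 , λ r 1≤r → dimension r r 0 , dimension-bound r , λ n n₀<n →
  subst (λ n → (χ : Point n → Fin r) → Monochromatic χ) (m+[n∸m]≡n (<⇒≤ n₀<n))
        (padded-cube r (n ∸ dimension r r 0) {{>-nonZero 1≤r}})
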